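{- Let $\mathcal A$ be a commutative unital $\mathbb Q$-algebra and let $G_{\mathcal A}$ be the set of unital algebra morphisms $(\mathcal H,\ast)\to\mathcal A$, which is a group under the convolution product $\phi\star\psi=m_{\mathcal A}\circ(\phi\otimes\psi)\circ\Delta$ with unit $e=u_{\mathcal A}\circ\varepsilon$. Then the set $T_{\mathcal A}:=\{\phi\in G_{\mathcal A} : \phi|_N=0\}$ is a subgroup of $(G_{\mathcal A},\star,e)$.
   Context: $Y=\{z_k:k\in\mathbb Z\}$, and $\mathcal H=\langle Y\rangle_{\mathbb Q}$ is the $\mathbb Q$-vector space spanned by words in $Y$ (empty word $\mathbf 1$), equipped with the quasi-shuffle product $\ast$ defined by $\mathbf 1\ast w=w\ast\mathbf 1=w$ and $z_mu\ast z_nv=z_m(u\ast z_nv)+z_n(z_mu\ast v)+z_{m+n}(u\ast v)$ for words $u,v,w$ and $m,n\in\mathbb Z$; unit $\lambda\mapsto\lambda\mathbf 1$; deconcatenation coproduct $\Delta(w)=\sum_{uv=w}u\otimes v$; counit $\varepsilon(\mathbf 1)=1$, $\varepsilon(w)=0$ for nonempty words $w$. This is a Hopf algebra. A word $z_{k_1}\cdots z_{k_n}$ ($n\ge1$) is non-singular if $k_1\neq1$, $k_1+k_2\notin\{2,1,0,-2,-4,\ldots\}$ (when $n\ge2$), and $k_1+\cdots+k_j\notin\mathbb Z_{\le j}$ for all $3\le j\le n$. $N$ denotes the $\mathbb Q$-linear span of non-singular words. $m_{\mathcal A}$ is the multiplication of $\mathcal A$ and $u_{\mathcal A}$ its unit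 map. -}

module Defs where

open import Level using (Level; _⊔_; suc)
open import Data.Integer using (ℤ; +_; -[1+_]) renaming (_+_ to _+ℤ_; _≤_ to _≤ℤ_)
open import Data.Integer.Divisibility using (_∣_)
open import Data.Nat using (ℕ; zero) renaming (suc to sucℕ)
open import Data.List using (List; []; _∷_; map; _++_; foldr)
open import Data.Product using (_×_; _,_)
open import Data.Unit using (⊤)
open import Data.Empty using (⊥)
open import Data.Sum using (_⊎_)
open import Relation.Nullary using (¬_)
open import Relation.Binary.PropositionalEquality using (_≡_)
open import Algebra.Bundles using (CommutativeRing)
open import Algebra.Morphism.Structures using (module RingMorphisms)
open import Data.Rational using (ℚ)
import Data.Rational.Properties as ℚP

record QAlgebra (c ℓ : Level) : Set (suc (c ⊔ ℓ)) where
  field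
    commRing : CommutativeRing c ℓ
  open CommutativeRing commRing public
  field
    embed : ℚ → Carrier
    embed-isRingHomomorphism :
      RingMorphisms.IsRingHomomorphism ℚP.+-*-rawRing rawRing embed

-- Words over Y = {z_k : k ∈ ℤ}: z_{k₁}⋯z_{kₙ} is the list k₁ ∷ … ∷ kₙ ∷ [].
-- The empty list is the empty word 𝟏.  Words form a ℚ-basis of 𝓗, so a
-- ℚ-linear map 𝓗 → 𝓐 is the same thing as a function Word → 𝓐.

Word : Set
Word = List ℤ

-- Quasi-shuffle product of two words, as the formal sum of words
-- (a list of words, listed with multiplicity; all coefficients are 1).
_⋆q_ : Word → Word → List Word
[] ⋆q v = v ∷ []
(m ∷ u) ⋆q [] = (m ∷ u) ∷ []
(m ∷ u) ⋆q (n ∷ v) =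
  map (m ∷_) (u ⋆q (n ∷ v)) ++
  map (n ∷_) ((m ∷ u) ⋆q v) ++
  map ((m +ℤ n) ∷_) (u ⋆q v)

splits : Word → List (Word × Word)
splits []      = ([] , []) ∷ []
splits (x ∷ w) = ([] , x ∷ w) ∷ map (λ { (u , v) → (x ∷ u , v) }) (splits w)

BadPair : ℤ → Set
BadPair s = s ≡ + 2 ⊎ s ≡ + 1 ⊎ s ≡ + 0 ⊎ (s ≤ℤ -[1+ 0 ] × + 2 ∣ s)

-- Condition k₁ + ⋯ + k_j ∉ ℤ_{≤ j} for j ≥ 3 onwards; arguments: j, the
-- partial sum k₁+⋯+k_{j-1} so far, and the remaining letters k_j, k_{j+1}, ….
TailOK : ℕ → ℤ → Word → Set
TailOK j s []      = ⊤
TailOK j s (k ∷ w) = ¬ (s +ℤ k ≤ℤ + j) × TailOK (sucℕ j) (s +ℤ k) w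

NonSingular : Word → Set
NonSingular []             = ⊥
NonSingular (k₁ ∷ [])      = ¬ (k₁ ≡ + 1)
NonSingular (k₁ ∷ k₂ ∷ w)  =
  ¬ (k₁ ≡ + 1) × ¬ BadPair (k₁ +ℤ k₂) × TailOK 3 (k₁ +ℤ k₂) w

module _ {c ℓ : Level} (𝓐 : QAlgebra c ℓ) where
  open QAlgebra 𝓐

  -- linear extension of φ : Word → 𝓐 to a formal sum of words
  sumMap : {X : Set} → (X → Carrier) → List X → Carrier
  sumMap f = foldr (λ x r → f x + r) 0#

  IsCharacter : (Word → Carrier) → Set ℓ
  IsCharacter φ =
    (φ [] ≈ 1#) ×
    (∀ u v → φ u * φ v ≈ sumMap φ (u ⋆q v))

  conv : (Word → Carrier) → (Word → Carrier) → Word → Carrier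
  conv φ ψ w = sumMap (λ { (u , v) → φ u * ψ v }) (splits w)

  unitChar : Word → Carrier
  unitChar []      = 1#
  unitChar (_ ∷ _) = 0#

  -- φ|_N = 0  (equivalently, by linearity, φ vanishes on non-singular words)
  VanishesOnN : (Word → Carrier) → Set ℓ
  VanishesOnN φ = ∀ w → NonSingular w → φ w ≈ 0#

  InT : (Word → Carrier) → Set ℓ
  InT φ = IsCharacter φ × VanishesOnN φ

  IsSubgroupT : Set (c ⊔ ℓ)
  IsSubgroupT =
    InT unitChar ×
    (∀ φ ψ → InT φ → InT ψ → InT (conv φ ψ)) ×
    (∀ φ ψ → InT φ → IsCharacter ψ →
       (∀ w → conv φ ψ w ≈ unitChar w) →
       (∀ w → conv ψ φ w ≈ unitChar w) →
       InT ψ)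

-- Convolution preserves characters because deconcatenation is multiplicative for the
-- quasi-shuffle product, Δ(u ∗ v) = Δu ∗ Δv; this is proved by a simultaneous induction
-- on u and v, against an arbitrary linear form f on 𝓗 ⊗ 𝓗 so that first letters can be
-- absorbed into f.  Vanishing on N rests on N being closed under nonempty prefixes: if φ
-- vanishes on N, then (φ ⋆ ψ)(w) = φ(𝟏) ψ(w) for w ∈ N, because every other term of Δw
-- has a nonempty prefix of w as its left factor.  This gives closure under ⋆ at once, and
-- for a character ψ with φ ⋆ ψ = e it gives ψ(w) = (φ ⋆ ψ)(w) = e(w) = 0.

module Submission where

open import Level using (Level)
open import Algebra.Bundles using (CommutativeMonoid)
open import Data.Integer using () renaming (_+_ to _+ℤ_)
open import Data.List using (List; []; _∷_; map; _++_; foldr)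
open import Data.List.Membership.Propositional using (_∈_)
open import Data.List.Membership.Propositional.Properties using (∈-map⁻)
open import Data.List.Relation.Unary.Any using (here; there)
open import Data.Product using (_,_; proj₁; proj₂; uncurry)
open import Data.Unit using (tt)
open import Relation.Binary.PropositionalEquality as ≡ using (_≡_)
open import Defs

⋆q-identityʳ : ∀ u → u ⋆q [] ≡ u ∷ []
⋆q-identityʳ []      = ≡.refl
⋆q-identityʳ (_ ∷ _) = ≡.refl

∈-splits⇒++ : ∀ {a b} w → (a , b) ∈ splits w → a ++ b ≡ w
∈-splits⇒++ []      (here ≡.refl) = ≡.refl
∈-splits⇒++ (x ∷ w) (here ≡.refl) = ≡.refl
∈-splits⇒++ (x ∷ w) (there p) with ∈-map⁻ _ p
... | (a , b) , q , ≡.refl = ≡.cong (x ∷_) (∈-splits⇒++ w q)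

tailOK-++⁻ˡ : ∀ j s a b → TailOK j s (a ++ b) → TailOK j s a
tailOK-++⁻ˡ j s []      b _       = tt
tailOK-++⁻ˡ j s (k ∷ a) b (h , t) = h , tailOK-++⁻ˡ _ _ a b t

nonSingular-++⁻ˡ : ∀ k a b → NonSingular (k ∷ a ++ b) → NonSingular (k ∷ a)
nonSingular-++⁻ˡ k []       []      h              = h
nonSingular-++⁻ˡ k []       (_ ∷ _) (h , _)        = h
nonSingular-++⁻ˡ k (k₂ ∷ a) b       (h₁ , h₂ , h₃) = h₁ , h₂ , tailOK-++⁻ˡ 3 _ a b h₃

module WordSums {c ℓ : Level} (M : CommutativeMonoid c ℓ) where
  open CommutativeMonoid M renaming (_∙_ to _+_; ε to 0#; ∙-cong to +-cong)

  open import Relation.Binary.Reasoning.Setoid setoid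
  open import Algebra.Properties.CommutativeSemigroup commutativeSemigroup using (interchange)
  open import Algebra.Solver.CommutativeMonoid M using (solve; _⊜_; _⊕_)

  ∑ : {X : Set} → List X → (X → Carrier) → Carrier
  ∑ xs g = foldr (λ x r → g x + r) 0# xs

  ∑-cong : {X : Set} (xs : List X) {g h : X → Carrier} → (∀ x → g x ≈ h x) → ∑ xs g ≈ ∑ xs h
  ∑-cong []       g≈h = refl
  ∑-cong (x ∷ xs) g≈h = +-cong (g≈h x) (∑-cong xs g≈h)

  ∑-zero : {X : Set} (xs : List X) {g : X → Carrier} → (∀ {x} → x ∈ xs → g x ≈ 0#) → ∑ xs g ≈ 0#
  ∑-zero []       g≈0 = refl
  ∑-zero (x ∷ xs) g≈0 = trans (+-cong (g≈0 (here ≡.refl)) (∑-zero xs (λ p → g≈0 (there p)))) (identityˡ 0#)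

  ∑-++ : {X : Set} (xs ys : List X) (g : X → Carrier) → ∑ (xs ++ ys) g ≈ ∑ xs g + ∑ ys g
  ∑-++ []       ys g = sym (identityˡ _)
  ∑-++ (x ∷ xs) ys g = trans (+-cong refl (∑-++ xs ys g)) (sym (assoc _ _ _))

  ∑-map : {X Y : Set} (h : X → Y) (xs : List X) (g : Y → Carrier) → ∑ (map h xs) g ≡ ∑ xs (λ x → g (h x))
  ∑-map h []       g = ≡.refl
  ∑-map h (x ∷ xs) g = ≡.cong (g (h x) +_) (∑-map h xs g)

  ∑-+ : {X : Set} (xs : List X) (g h : X → Carrier) → ∑ xs (λ x → g x + h x) ≈ ∑ xs g + ∑ xs h
  ∑-+ []       g h = sym (identityˡ _)
  ∑-+ (x ∷ xs) g h = trans (+-cong refl (∑-+ xs g h)) (interchange _ _ _ _)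

  ∑-⋆q-cons : ∀ m u n v (g : Word → Carrier) →
              ∑ ((m ∷ u) ⋆q (n ∷ v)) g
                ≈ ∑ (u ⋆q (n ∷ v)) (λ w → g (m ∷ w))
                  + (∑ ((m ∷ u) ⋆q v) (λ w → g (n ∷ w)) + ∑ (u ⋆q v) (λ w → g (m +ℤ n ∷ w)))
  ∑-⋆q-cons m u n v g = begin
      ∑ (map (m ∷_) A₁ ++ map (n ∷_) A₂ ++ map (m +ℤ n ∷_) A₃) g
    ≈⟨ trans (∑-++ (map (m ∷_) A₁) _ g) (+-cong refl (∑-++ (map (n ∷_) A₂) _ g)) ⟩
      ∑ (map (m ∷_) A₁) g + (∑ (map (n ∷_) A₂) g + ∑ (map (m +ℤ n ∷_) A₃) g)
    ≈⟨ +-cong (reflexive (∑-map (m ∷_) A₁ g))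
              (+-cong (reflexive (∑-map (n ∷_) A₂ g)) (reflexive (∑-map (m +ℤ n ∷_) A₃ g))) ⟩
      ∑ A₁ (λ w → g (m ∷ w)) + (∑ A₂ (λ w → g (n ∷ w)) + ∑ A₃ (λ w → g (m +ℤ n ∷ w)))
    ∎
    where
    A₁ = u ⋆q (n ∷ v)
    A₂ = (m ∷ u) ⋆q v
    A₃ = u ⋆q v

  ∑Δ : (Word → Word → Carrier) → Word → Carrier
  ∑Δ f w = ∑ (splits w) (uncurry f)

  ∑Δ⁺ : (Word → Word → Carrier) → Word → Carrier
  ∑Δ⁺ f []      = 0#
  ∑Δ⁺ f (x ∷ w) = ∑Δ (λ a → f (x ∷ a)) w

  ∑Δ-cong : ∀ w {f g : Word → Word → Carrier} → (∀ a b → f a b ≈ g a b) → ∑Δ f w ≈ ∑Δ g w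
  ∑Δ-cong w f≈g = ∑-cong (splits w) (λ (a , b) → f≈g a b)

  ∑Δ-+ : ∀ w (f g : Word → Word → Carrier) → ∑Δ (λ a b → f a b + g a b) w ≈ ∑Δ f w + ∑Δ g w
  ∑Δ-+ w f g = ∑-+ (splits w) (uncurry f) (uncurry g)

  ∑Δ-head : ∀ f w → ∑Δ f w ≈ f [] w + ∑Δ⁺ f w
  ∑Δ-head f []      = refl
  ∑Δ-head f (x ∷ w) = +-cong refl (reflexive (∑-map _ (splits w) (uncurry f)))

  ∑Δ-zero : ∀ f w → (∀ a b → a ++ b ≡ w → f a b ≈ 0#) → ∑Δ f w ≈ 0#
  ∑Δ-zero f w f≈0 = ∑-zero (splits w) (λ {(a , b)} p → f≈0 a b (∈-splits⇒++ w p))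

  -- f((a ⊗ b) ∗ (c ⊗ d)), reading f as a linear form on 𝓗 ⊗ 𝓗
  ∑⊗⋆ : (Word → Word → Carrier) → Word → Word → Word → Word → Carrier
  ∑⊗⋆ f a b c d = ∑ (a ⋆q c) (λ x → ∑ (b ⋆q d) (f x))

  ∑⊗⋆-identityʳ : ∀ f a b → ∑⊗⋆ f a b [] [] ≈ f a b
  ∑⊗⋆-identityʳ f a b rewrite ⋆q-identityʳ a | ⋆q-identityʳ b = trans (identityʳ _) (identityʳ _)

  ∑⊗⋆-identityˡ : ∀ f c d → ∑⊗⋆ f [] [] c d ≈ f c d
  ∑⊗⋆-identityˡ f c d = trans (identityʳ _) (identityʳ _)

  ∑⊗⋆-cons-[] : ∀ f m a b d → ∑⊗⋆ f (m ∷ a) b [] d ≈ ∑⊗⋆ (λ x → f (m ∷ x)) a b [] d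
  ∑⊗⋆-cons-[] f m a b d rewrite ⋆q-identityʳ a = refl

  ∑Δ² : (Word → Word → Word → Word → Carrier) → Word → Word → Carrier
  ∑Δ² g u v = ∑Δ (λ a b → ∑Δ (g a b) v) u

  ∑Δ²-cong : ∀ u v {g h : Word → Word → Word → Word → Carrier} →
             (∀ a b c d → g a b c d ≈ h a b c d) → ∑Δ² g u v ≈ ∑Δ² h u v
  ∑Δ²-cong u v g≈h = ∑Δ-cong u (λ a b → ∑Δ-cong v (g≈h a b))

  ∑Δ²-+ : ∀ g h u v → ∑Δ² (λ a b c d → g a b c d + h a b c d) u v ≈ ∑Δ² g u v + ∑Δ² h u v
  ∑Δ²-+ g h u v = trans (∑Δ-cong u (λ a b → ∑Δ-+ v (g a b) (h a b))) (∑Δ-+ u _ _)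

  -- f(Δ(u ∗ v)) and f(Δu ∗ Δv)
  ∑Δ⋆ : (Word → Word → Carrier) → Word → Word → Carrier
  ∑Δ⋆ f u v = ∑ (u ⋆q v) (∑Δ f)

  ∑Δ⋆Δ : (Word → Word → Carrier) → Word → Word → Carrier
  ∑Δ⋆Δ f = ∑Δ² (∑⊗⋆ f)

  ∑Δ⋆-cons : ∀ f m u n v →
             ∑Δ⋆ f (m ∷ u) (n ∷ v)
               ≈ ∑ ((m ∷ u) ⋆q (n ∷ v)) (f [])
                 + (∑Δ⋆ (λ a → f (m ∷ a)) u (n ∷ v)
                   + (∑Δ⋆ (λ a → f (n ∷ a)) (m ∷ u) v + ∑Δ⋆ (λ a → f (m +ℤ n ∷ a)) u v))
  ∑Δ⋆-cons f m u n v =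
    trans (∑-cong ((m ∷ u) ⋆q (n ∷ v)) (∑Δ-head f))
          (trans (∑-+ ((m ∷ u) ⋆q (n ∷ v)) (f []) (∑Δ⁺ f))
                 (+-cong refl (∑-⋆q-cons m u n v (∑Δ⁺ f))))

  ∑Δ⋆Δ-cons : ∀ f m u n v →
              ∑Δ⋆Δ f (m ∷ u) (n ∷ v)
                ≈ ∑ ((m ∷ u) ⋆q (n ∷ v)) (f [])
                  + (∑Δ⋆Δ (λ a → f (m ∷ a)) u (n ∷ v)
                    + (∑Δ⋆Δ (λ a → f (n ∷ a)) (m ∷ u) v + ∑Δ⋆Δ (λ a → f (m +ℤ n ∷ a)) u v))
  ∑Δ⋆Δ-cons f m u n v = begin
      ∑Δ⋆Δ f U V
    ≈⟨ trans (∑Δ-head _ U) (+-cong (∑Δ-head _ V) (∑Δ-cong u (λ a b → ∑Δ-head _ V))) ⟩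
      (∑⊗⋆ f [] U [] V + P) + ∑Δ (λ a b → ∑⊗⋆ f (m ∷ a) b [] V + ∑Δ⁺ (∑⊗⋆ f (m ∷ a) b) V) u
    ≈⟨ +-cong (+-cong (identityʳ _) refl) (∑Δ-+ u _ _) ⟩
      (T + P) + (∑Δ (λ a b → ∑⊗⋆ f (m ∷ a) b [] V) u + ∑Δ² (λ a b c d → ∑⊗⋆ f (m ∷ a) b (n ∷ c) d) u v)
    ≈⟨ +-cong refl (+-cong (∑Δ-cong u (λ a b → ∑⊗⋆-cons-[] f m a b V))
                           (∑Δ²-cong u v (λ a b c d → ∑-⋆q-cons m a n c _))) ⟩
      (T + P) + (Q + ∑Δ² (λ a b c d → X₁ a b c d + (X₂ a b c d + X₃ a b c d)) u v)
    ≈⟨ +-cong refl (+-cong refl (trans (∑Δ²-+ X₁ _ u v) (+-cong refl (∑Δ²-+ X₂ X₃ u v)))) ⟩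
      (T + P) + (Q + (∑Δ² X₁ u v + (∑Δ² X₂ u v + ∑Δ² X₃ u v)))
    ≈⟨ solve 6 (λ t p q x₁ x₂ x₃ → (t ⊕ p) ⊕ (q ⊕ (x₁ ⊕ (x₂ ⊕ x₃)))
                                 ⊜ t ⊕ ((q ⊕ x₁) ⊕ ((p ⊕ x₂) ⊕ x₃))) refl
               T P Q (∑Δ² X₁ u v) (∑Δ² X₂ u v) (∑Δ² X₃ u v) ⟩
      T + ((Q + ∑Δ² X₁ u v) + ((P + ∑Δ² X₂ u v) + ∑Δ² X₃ u v))
    ≈⟨ sym (+-cong refl (+-cong (trans (∑Δ-cong u (λ a b → ∑Δ-head _ V)) (∑Δ-+ u _ _))
                                 (+-cong (∑Δ-head _ U) refl))) ⟩
      T + (∑Δ⋆Δ fm u V + (∑Δ⋆Δ fn U v + ∑Δ⋆Δ fk u v))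
    ∎
    where
    U = m ∷ u
    V = n ∷ v
    fm fn fk : Word → Word → Carrier
    fm a = f (m ∷ a)
    fn a = f (n ∷ a)
    fk a = f (m +ℤ n ∷ a)
    T = ∑ (U ⋆q V) (f [])
    P = ∑Δ (∑⊗⋆ fn [] U) v
    Q = ∑Δ (λ a b → ∑⊗⋆ fm a b [] V) u
    X₁ X₂ X₃ : Word → Word → Word → Word → Carrier
    X₁ a b c d = ∑⊗⋆ fm a b (n ∷ c) d
    X₂ a b = ∑⊗⋆ fn (m ∷ a) b
    X₃ = ∑⊗⋆ fk

  ∑Δ⋆≈∑Δ⋆Δ : ∀ f u v → ∑Δ⋆ f u v ≈ ∑Δ⋆Δ f u v
  ∑Δ⋆≈∑Δ⋆Δ f []      v       = +-cong (∑Δ-cong v (λ c d → sym (∑⊗⋆-identityˡ f c d))) refl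
  ∑Δ⋆≈∑Δ⋆Δ f (m ∷ u) []      =
    trans (identityʳ _) (∑Δ-cong (m ∷ u) (λ a b → sym (trans (identityʳ _) (∑⊗⋆-identityʳ f a b))))
  ∑Δ⋆≈∑Δ⋆Δ f (m ∷ u) (n ∷ v) =
    trans (∑Δ⋆-cons f m u n v)
          (trans (+-cong refl (+-cong (∑Δ⋆≈∑Δ⋆Δ _ u (n ∷ v))
                                      (+-cong (∑Δ⋆≈∑Δ⋆Δ _ (m ∷ u) v) (∑Δ⋆≈∑Δ⋆Δ _ u v))))
                 (sym (∑Δ⋆Δ-cons f m u n v)))

module Characters {c ℓ : Level} (𝓐 : QAlgebra c ℓ) where
  open QAlgebra 𝓐
  open WordSums +-commutativeMonoid
  open import Relation.Binary.Reasoning.Setoid setoid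
  open import Algebra.Properties.CommutativeSemigroup *-commutativeSemigroup using (interchange)

  ∑-distribˡ : {X : Set} (xs : List X) (a : Carrier) (g : X → Carrier) → a * ∑ xs g ≈ ∑ xs (λ x → a * g x)
  ∑-distribˡ []       a g = zeroʳ a
  ∑-distribˡ (x ∷ xs) a g = trans (distribˡ a _ _) (+-cong refl (∑-distribˡ xs a g))

  ∑-distribʳ : {X : Set} (xs : List X) (a : Carrier) (g : X → Carrier) → ∑ xs g * a ≈ ∑ xs (λ x → g x * a)
  ∑-distribʳ []       a g = zeroˡ a
  ∑-distribʳ (x ∷ xs) a g = trans (distribʳ a _ _) (+-cong refl (∑-distribʳ xs a g))

  ∑Δ-* : ∀ f g u v → ∑Δ f u * ∑Δ g v ≈ ∑Δ² (λ a b c d → f a b * g c d) u v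
  ∑Δ-* f g u v = trans (∑-distribʳ (splits u) _ _) (∑Δ-cong u (λ a b → ∑-distribˡ (splits v) _ _))

  module _ {φ ψ : Word → Carrier} (φ-char : IsCharacter 𝓐 φ) (ψ-char : IsCharacter 𝓐 ψ) where

    ⊗-multiplicative : ∀ a b c d → (φ a * ψ b) * (φ c * ψ d) ≈ ∑⊗⋆ (λ x y → φ x * ψ y) a b c d
    ⊗-multiplicative a b c d = begin
        (φ a * ψ b) * (φ c * ψ d)
      ≈⟨ interchange _ _ _ _ ⟩
        (φ a * φ c) * (ψ b * ψ d)
      ≈⟨ *-cong (proj₂ φ-char a c) (proj₂ ψ-char b d) ⟩
        ∑ (a ⋆q c) φ * ∑ (b ⋆q d) ψ
      ≈⟨ ∑-distribʳ (a ⋆q c) _ _ ⟩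
        ∑ (a ⋆q c) (λ x → φ x * ∑ (b ⋆q d) ψ)
      ≈⟨ ∑-cong (a ⋆q c) (λ x → ∑-distribˡ (b ⋆q d) _ _) ⟩
        ∑⊗⋆ (λ x y → φ x * ψ y) a b c d
      ∎

    conv-isCharacter : IsCharacter 𝓐 (conv 𝓐 φ ψ)
    conv-isCharacter = conv-unital , conv-multiplicative
      where
      conv-unital : conv 𝓐 φ ψ [] ≈ 1#
      conv-unital = trans (+-identityʳ _) (trans (*-cong (proj₁ φ-char) (proj₁ ψ-char)) (*-identityˡ 1#))

      conv-multiplicative : ∀ u v → conv 𝓐 φ ψ u * conv 𝓐 φ ψ v ≈ sumMap 𝓐 (conv 𝓐 φ ψ) (u ⋆q v)
      conv-multiplicative u v = begin
          conv 𝓐 φ ψ u * conv 𝓐 φ ψ v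
        ≈⟨ ∑Δ-* _ _ u v ⟩
          ∑Δ² (λ a b c d → (φ a * ψ b) * (φ c * ψ d)) u v
        ≈⟨ ∑Δ²-cong u v ⊗-multiplicative ⟩
          ∑Δ⋆Δ (λ a b → φ a * ψ b) u v
        ≈⟨ sym (∑Δ⋆≈∑Δ⋆Δ _ u v) ⟩
          sumMap 𝓐 (conv 𝓐 φ ψ) (u ⋆q v)
        ∎

  unitChar-isCharacter : IsCharacter 𝓐 (unitChar 𝓐)
  unitChar-isCharacter = refl , multiplicative
    where
    multiplicative : ∀ u v → unitChar 𝓐 u * unitChar 𝓐 v ≈ sumMap 𝓐 (unitChar 𝓐) (u ⋆q v)
    multiplicative []      v       = trans (*-identityˡ _) (sym (+-identityʳ _))
    multiplicative (m ∷ u) []      = trans (zeroˡ _) (sym (+-identityʳ _))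
    multiplicative (m ∷ u) (n ∷ v) = trans (zeroˡ _) (sym (begin
        ∑ ((m ∷ u) ⋆q (n ∷ v)) (unitChar 𝓐)
      ≈⟨ ∑-⋆q-cons m u n v (unitChar 𝓐) ⟩
        ∑ (u ⋆q (n ∷ v)) (λ _ → 0#) + (∑ ((m ∷ u) ⋆q v) (λ _ → 0#) + ∑ (u ⋆q v) (λ _ → 0#))
      ≈⟨ +-cong (∑-zero (u ⋆q (n ∷ v)) (λ _ → refl))
                (+-cong (∑-zero ((m ∷ u) ⋆q v) (λ _ → refl)) (∑-zero (u ⋆q v) (λ _ → refl))) ⟩
        0# + (0# + 0#)
      ≈⟨ trans (+-identityˡ _) (+-identityˡ _) ⟩
        0#
      ∎))

  unitChar-vanishesOnN : VanishesOnN 𝓐 (unitChar 𝓐)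
  unitChar-vanishesOnN (_ ∷ _) _ = refl

  conv-vanishesOnNˡ : ∀ {φ} ψ → VanishesOnN 𝓐 φ → ∀ w → NonSingular w → conv 𝓐 φ ψ w ≈ φ [] * ψ w
  conv-vanishesOnNˡ {φ} ψ φ-N (x ∷ w) ns = begin
      conv 𝓐 φ ψ (x ∷ w)
    ≈⟨ ∑Δ-head (λ a b → φ a * ψ b) (x ∷ w) ⟩
      φ [] * ψ (x ∷ w) + ∑Δ (λ a b → φ (x ∷ a) * ψ b) w
    ≈⟨ +-cong refl (∑Δ-zero _ w prefix-vanishes) ⟩
      φ [] * ψ (x ∷ w) + 0#
    ≈⟨ +-identityʳ _ ⟩
      φ [] * ψ (x ∷ w)
    ∎
    where
    prefix-vanishes : ∀ a b → a ++ b ≡ w → φ (x ∷ a) * ψ b ≈ 0#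
    prefix-vanishes a b ≡.refl = trans (*-cong (φ-N (x ∷ a) (nonSingular-++⁻ˡ x a b ns)) refl) (zeroˡ _)

mainTheorem2 : {c ℓ : Level} (𝓐 : QAlgebra c ℓ) → IsSubgroupT 𝓐
mainTheorem2 𝓐 = (unitChar-isCharacter , unitChar-vanishesOnN) , closed , inverse
  where
  open QAlgebra 𝓐
  open Characters 𝓐

  closed : ∀ φ ψ → InT 𝓐 φ → InT 𝓐 ψ → InT 𝓐 (conv 𝓐 φ ψ)
  closed φ ψ (φ-char , φ-N) (ψ-char , ψ-N) = conv-isCharacter φ-char ψ-char , λ w ns →
    trans (conv-vanishesOnNˡ ψ φ-N w ns) (trans (*-cong refl (ψ-N w ns)) (zeroʳ _))

  inverse : ∀ φ ψ → InT 𝓐 φ → IsCharacter 𝓐 ψ →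
            (∀ w → conv 𝓐 φ ψ w ≈ unitChar 𝓐 w) → (∀ w → conv 𝓐 ψ φ w ≈ unitChar 𝓐 w) → InT 𝓐 ψ
  inverse φ ψ ((φ-unital , _) , φ-N) ψ-char φ⋆ψ≈e _ = ψ-char , λ w ns →
    trans (sym (trans (conv-vanishesOnNˡ ψ φ-N w ns) (trans (*-cong φ-unital refl) (*-identityˡ _))))
          (trans (φ⋆ψ≈e w) (unitChar-vanishesOnN w ns))
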